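{- Let $k\ge2$, $n\in\mathbb{N}$ and $w\in S_n$. If there exists $i_0\in\mathbb{N}$ such that $w_i<w_{i+1}$ for all indices $i$ with $i_0\le i\le n-1$, then $\mathcal{C}_{k,n,w}$ has at most $\sum_{j=1}^{i_0-1}(k-1)k^{j-1}$ descents and at most $\binom{k}{2}\sum_{i=1}^{i_0-1}k^{i-1}\binom{k^{n-i}}{2}$ inversions.
   Context: The infinite rooted directed $k$-ary tree has a root on layer $1$; every vertex has $k$ children, ordered left to right, on the next layer. A vertex with at least $k$ chips may fire by choosing $k$ of its labeled chips and sending the $j$th smallest to its $j$th leftmost child. Chips $0,\dots,k^n-1$ start at the root and are written in $n$-digit $k$-ary expansion. For $w\in S_n$, the strategy $F_w$ fires, for each $i\in[n]$, each vertex $v$ on layer $i$ so that all chips on $v$ whose $w_i$th most significant digit equals $j$ go to the $(j+1)$th leftmost child of $v$. $\mathcal{C}_{k,n,w}=(\pi_1,\dots,\pi_{k^n})$ is the resulting stable configuration, read as the sequence of chips on layer $n+1$ from left to right. A descent is an $i$ with $\pi_i>\pi_{i+1}$; an inversion is a pair of positions $a<b$ with $\pi_a>\pi_b$. -}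

module Defs where

open import Data.Bool using (if_then_else_)

open import Data.Nat using (ℕ; zero; suc; _+_; _*_; _∸_; _^_; _<_; _<?_; _≟_; _<ᵇ_)
open import Data.Nat.DivMod using (_/_; _%_)
open import Data.Nat.Properties using (m^n≢0)
open import Data.Fin using (Fin; toℕ)
open import Data.Fin.Permutation using (Permutation′; _⟨$⟩ʳ_)
open import Data.List using (List; []; _∷_; filter; concatMap; upTo; allFin; map; length)

-- p-th most significant digit (p : Fin n, 0-indexed, so p = 0 is the most
-- significant) of the n-digit base-k expansion of c.  For k = 0 (excluded by
-- the hypothesis k ≥ 2) an arbitrary value 0 is returned.
digit : (k n : ℕ) → Fin n → ℕ → ℕ
digit zero n p c = 0
digit (suc k) n p c = (_/_ c (suc k ^ (n ∸ suc (toℕ p))) {{m^n≢0 (suc k) (n ∸ suc (toℕ p))}}) % suc k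

-- Run the strategy below a vertex holding the chips `chips`, where `ps` lists
-- the digit positions used on the current and subsequent layers.  The result
-- is the list of chips on the bottom layer below this vertex, read left to
-- right: the vertex sends the chips whose digit at position p equals j to its
-- (j+1)-th leftmost child (j = 0,…,k-1).
fire : (k n : ℕ) → List ℕ → List (Fin n) → List ℕ
fire k n chips [] = chips
fire k n chips (p ∷ ps) =
  concatMap (λ j → fire k n (filter (λ c → digit k n p c ≟ j) chips) ps) (upTo k)

-- C_{k,n,w}: chips 0,…,k^n-1 at the root; layer i (1-indexed) fires by
-- digit position w_i.
config : (k n : ℕ) → Permutation′ n → List ℕ
config k n w = fire k n (upTo (k ^ n)) (map (w ⟨$⟩ʳ_) (allFin n))

descents : List ℕ → ℕ
descents [] = 0
descents (x ∷ r) = go x r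
  where
  go : ℕ → List ℕ → ℕ
  go x [] = 0
  go x (y ∷ r) = (if y <ᵇ x then 1 else 0) + go y r

inversions : List ℕ → ℕ
inversions [] = 0
inversions (x ∷ r) = length (filter (λ y → y <? x) r) + inversions r

sum1 : ℕ → (ℕ → ℕ) → ℕ
sum1 zero f = 0
sum1 (suc m) f = sum1 m f + f (suc m)

{-# OPTIONS --safe #-}
-- The chips 0, …, kⁿ − 1 realise every base-k digit string exactly once, so the leaf reached
-- through the digits j₁, …, jₙ at positions w₁, …, wₙ holds exactly the chip Σ jᵢ k^(n − wᵢ).
-- Hence C_{k,n,w} arises from [0] by n rounds of "concatenate k copies of the list, the j-th
-- shifted up by j k^(n − wᵢ)", the innermost round being i = n. One round turns a list L into a
-- list with at most k (des L + 1) − 1 descents and at most k inv L + C(k,2) C(|L|,2) inversions: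
-- a higher copy is inverted against a lower one only at pairs of distinct positions of L, and at
-- most once per unordered pair. If w increases from i₀ on, the exponents n − wᵢ of the innermost
-- rounds decrease, so these rounds build an increasing list, and iterating the two estimates over
-- the remaining i₀ − 1 rounds gives the bounds, using Σ (k − 1) k^(j − 1) = k^(i₀ − 1) − 1.
module Submission where

open import Defs
open import Data.Bool using (true; false; if_then_else_)
open import Data.Fin as Fin using (Fin; toℕ; fromℕ<; opposite)
open import Data.Fin.Permutation using (Permutation′; _⟨$⟩ʳ_; _⟨$⟩ˡ_; inverseˡ; inverseʳ)
open import Data.Fin.Properties using (toℕ<n; toℕ-injective; toℕ-fromℕ<; opposite-prop; opposite-involutive)
open import Data.List
  using (List; []; _∷_; [_]; _++_; map; concat; concatMap; filter; length; upTo; applyUpTo; take; drop; tabulate; allFin)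
open import Data.List.Effectful using (module MonadProperties)
open import Data.List.Membership.Propositional using (_∈_; _∉_)
open import Data.List.Membership.Propositional.Properties using (∈-map⁺; ∈-allFin)
open import Data.List.Properties
  using (∷-injectiveˡ; ∷-injectiveʳ; ≡-dec; ++-identityʳ; length-++; length-map; length-upTo; length-take;
         length-tabulate; take++drop≡id; upTo-∷ʳ; map-cong-local; map-tabulate; concatMap-cong; concatMap-map;
         concatMap-pure; filter-++; filter-none; filter-all; filter-accept; filter-reject; filter-≐)
open import Data.List.Relation.Unary.All as All using (All; []; _∷_)
import Data.List.Relation.Unary.All.Properties as All
open import Data.List.Relation.Unary.AllPairs as AllPairs using (AllPairs; []; _∷_)
import Data.List.Relation.Unary.AllPairs.Properties as AllPairs
open import Data.List.Relation.Unary.Any using (here; there)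
open import Data.List.Relation.Unary.Linked using (Linked; []; [-]; _∷_)
open import Data.List.Relation.Unary.Linked.Properties using (Linked⇒AllPairs)
open import Data.List.Relation.Unary.Unique.Propositional using (Unique)
import Data.List.Relation.Unary.Unique.Propositional.Properties as Unique
open import Data.Nat
open import Data.Nat.Combinatorics using (_C_; nC1≡n; nCk+nC[k+1]≡[n+1]C[k+1])
open import Data.Nat.Divisibility using (divides-refl)
open import Data.Nat.DivMod
open import Data.Nat.Properties
open import Algebra.Properties.CommutativeSemigroup +-commutativeSemigroup using (interchange; xy∙z≈xz∙y)
open import Data.Nat.Tactic.RingSolver using (solve-∀)
open import Data.Product using (_×_; _,_; proj₁; proj₂)
open import Data.Sum using (inj₁; inj₂)
open import Function using (_∘_)
open import Level using (0ℓ)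
open import Relation.Binary.Definitions using (tri<; tri≈; tri>)
open import Relation.Binary.PropositionalEquality hiding ([_])
open import Relation.Nullary using (does)
open import Relation.Nullary.Negation using (contradiction)
open import Relation.Nullary.Reflects using (ofʸ; ofⁿ)
open import Relation.Unary using (Pred; Decidable)
open import Relation.Unary.Properties using (_∩?_)

filter-filter : ∀ {A : Set} {P Q : Pred A 0ℓ} (P? : Decidable P) (Q? : Decidable Q) xs →
                filter P? (filter Q? xs) ≡ filter (Q? ∩? P?) xs
filter-filter P? Q? []       = refl
filter-filter P? Q? (x ∷ xs) with does (Q? x)
... | false = filter-filter P? Q? xs
... | true with does (P? x)
...   | false = filter-filter P? Q? xs
...   | true  = cong (x ∷_) (filter-filter P? Q? xs)

map-≡-∈ : ∀ {A B : Set} {f g : A → B} {xs x} → map f xs ≡ map g xs → x ∈ xs → f x ≡ g x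
map-≡-∈ {xs = _ ∷ _} fxs≡gxs (here refl) = ∷-injectiveˡ fxs≡gxs
map-≡-∈ {xs = _ ∷ _} fxs≡gxs (there x∈) = map-≡-∈ (∷-injectiveʳ fxs≡gxs) x∈

filter-upTo-unique : ∀ {P : Pred ℕ 0ℓ} (P? : Decidable P) {N v} → v < N → P v →
                     (∀ {c} → c < N → P c → c ≡ v) → filter P? (upTo N) ≡ [ v ]
filter-upTo-unique P? {suc N} {v} v<1+N Pv unique =
  trans (cong (filter P?) (sym (upTo-∷ʳ N))) (trans (filter-++ P? (upTo N) [ N ]) split)
  where
  split : filter P? (upTo N) ++ filter P? [ N ] ≡ [ v ]
  split with m≤n⇒m<n∨m≡n (s≤s⁻¹ v<1+N)
  ... | inj₁ v<N  = cong₂ _++_ (filter-upTo-unique P? v<N Pv (λ c<N → unique (m<n⇒m<1+n c<N)))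
                               (filter-reject P? (λ PN → <-irrefl (sym (unique (n<1+n N) PN)) v<N))
  ... | inj₂ refl = cong₂ _++_ (filter-none P? (All.applyUpTo⁺₁ (λ c → c) N
                                  (λ c<N Pc → <-irrefl (unique (m<n⇒m<1+n c<N) Pc) c<N)))
                               (filter-accept P? Pv)

linked-drop-tabulate : ∀ {A : Set} {R : A → A → Set} {m} (f : Fin m → A) t →
  (∀ a b → toℕ b ≡ suc (toℕ a) → t ≤ toℕ a → R (f a) (f b)) → Linked R (drop t (tabulate f))
linked-drop-tabulate {m = zero}        f zero    _    = []
linked-drop-tabulate {m = zero}        f (suc t) _    = []
linked-drop-tabulate {m = suc zero}    f zero    _    = [-]
linked-drop-tabulate {m = suc (suc m)} f zero    step =
  step Fin.zero (Fin.suc Fin.zero) refl z≤n ∷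
  linked-drop-tabulate (f ∘ Fin.suc) zero λ a b b≡1+a _ →
    step (Fin.suc a) (Fin.suc b) (cong suc b≡1+a) z≤n
linked-drop-tabulate {m = suc m}       f (suc t) step =
  linked-drop-tabulate (f ∘ Fin.suc) t λ a b b≡1+a t≤a →
    step (Fin.suc a) (Fin.suc b) (cong suc b≡1+a) (s≤s t≤a)

concatMap-cong-local : ∀ {A B : Set} {f g : A → List B} {xs} →
                       All (λ x → f x ≡ g x) xs → concatMap f xs ≡ concatMap g xs
concatMap-cong-local = cong concat ∘ map-cong-local

upTo-increasing : ∀ k → AllPairs _<_ (upTo k)
upTo-increasing k = AllPairs.applyUpTo⁺₁ (λ j → j) k (λ i<j _ → i<j)

length-take≤ : ∀ {A : Set} t (xs : List A) → length (take t xs) ≤ t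
length-take≤ t xs = ≤-trans (≤-reflexive (length-take t xs)) (m⊓n≤m t (length xs))

-- Descents and inversions of concatenated lists

⟦_<_⟧ : ℕ → ℕ → ℕ
⟦ y < x ⟧ = if y <ᵇ x then 1 else 0

⟦<⟧-mono : ∀ {x y x′ y′} → (y < x → y′ < x′) → ⟦ y < x ⟧ ≤ ⟦ y′ < x′ ⟧
⟦<⟧-mono {x} {y} {x′} {y′} f with y <ᵇ x | <ᵇ-reflects-< y x | y′ <ᵇ x′ | <ᵇ-reflects-< y′ x′
... | false | _      | _     | _       = z≤n
... | true  | _      | true  | _       = ≤-refl
... | true  | ofʸ p  | false | ofⁿ ¬q  = contradiction (f p) ¬q

⟦<⟧≤1 : ∀ x y → ⟦ y < x ⟧ ≤ 1
⟦<⟧≤1 x y with y <ᵇ x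
... | true  = ≤-refl
... | false = z≤n

⟦<⟧≡0 : ∀ {x y} → x ≤ y → ⟦ y < x ⟧ ≡ 0
⟦<⟧≡0 {x} {y} x≤y with y <ᵇ x | <ᵇ-reflects-< y x
... | true  | ofʸ y<x = contradiction x≤y (<⇒≱ y<x)
... | false | _       = refl

⟦<⟧+⟦>⟧≤1 : ∀ x y → ⟦ y < x ⟧ + ⟦ x < y ⟧ ≤ 1
⟦<⟧+⟦>⟧≤1 x y with y <ᵇ x | <ᵇ-reflects-< y x
... | true  | ofʸ y<x = ≤-reflexive (cong suc (⟦<⟧≡0 (<⇒≤ y<x)))
... | false | _       = ⟦<⟧≤1 y x

countBelow : ℕ → List ℕ → ℕ
countBelow x ys = length (filter (λ y → y <? x) ys)

countAbove : ℕ → List ℕ → ℕ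
countAbove x ys = length (filter (λ y → x <? y) ys)

countBelow-∷ : ∀ x y ys → countBelow x (y ∷ ys) ≡ ⟦ y < x ⟧ + countBelow x ys
countBelow-∷ x y ys with y <ᵇ x
... | true  = refl
... | false = refl

countAbove-∷ : ∀ x y ys → countAbove x (y ∷ ys) ≡ ⟦ x < y ⟧ + countAbove x ys
countAbove-∷ x y ys with x <ᵇ y
... | true  = refl
... | false = refl

countBelow-++ : ∀ x ys zs → countBelow x (ys ++ zs) ≡ countBelow x ys + countBelow x zs
countBelow-++ x ys zs = trans (cong length (filter-++ (λ y → y <? x) ys zs)) (length-++ (filter (λ y → y <? x) ys))

countBelow-map : ∀ {x x′} (f : ℕ → ℕ) → (∀ {y} → f y < x′ → y < x) → ∀ ys →
                 countBelow x′ (map f ys) ≤ countBelow x ys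
countBelow-map f reflect [] = z≤n
countBelow-map {x} {x′} f reflect (y ∷ ys) = begin
  countBelow x′ (f y ∷ map f ys)          ≡⟨ countBelow-∷ x′ (f y) (map f ys) ⟩
  ⟦ f y < x′ ⟧ + countBelow x′ (map f ys) ≤⟨ +-mono-≤ (⟦<⟧-mono reflect) (countBelow-map f reflect ys) ⟩
  ⟦ y < x ⟧ + countBelow x ys             ≡⟨ countBelow-∷ x y ys ⟨
  countBelow x (y ∷ ys)                   ∎
  where open ≤-Reasoning

countBelow+countAbove≤length : ∀ x ys → countBelow x ys + countAbove x ys ≤ length ys
countBelow+countAbove≤length x [] = z≤n
countBelow+countAbove≤length x (y ∷ ys) = begin
  countBelow x (y ∷ ys) + countAbove x (y ∷ ys)
    ≡⟨ cong₂ _+_ (countBelow-∷ x y ys) (countAbove-∷ x y ys) ⟩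
  (⟦ y < x ⟧ + countBelow x ys) + (⟦ x < y ⟧ + countAbove x ys)
    ≡⟨ interchange ⟦ y < x ⟧ (countBelow x ys) ⟦ x < y ⟧ (countAbove x ys) ⟩
  (⟦ y < x ⟧ + ⟦ x < y ⟧) + (countBelow x ys + countAbove x ys)
    ≤⟨ +-mono-≤ (⟦<⟧+⟦>⟧≤1 x y) (countBelow+countAbove≤length x ys) ⟩
  suc (length ys) ∎
  where open ≤-Reasoning

inversionsBetween : List ℕ → List ℕ → ℕ
inversionsBetween []       ys = 0
inversionsBetween (x ∷ xs) ys = countBelow x ys + inversionsBetween xs ys

inversionsBetween-[]ʳ : ∀ xs → inversionsBetween xs [] ≡ 0
inversionsBetween-[]ʳ []       = refl
inversionsBetween-[]ʳ (x ∷ xs) = inversionsBetween-[]ʳ xs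

inversionsBetween-++ʳ : ∀ xs ys zs →
  inversionsBetween xs (ys ++ zs) ≡ inversionsBetween xs ys + inversionsBetween xs zs
inversionsBetween-++ʳ []       ys zs = refl
inversionsBetween-++ʳ (x ∷ xs) ys zs = begin
  countBelow x (ys ++ zs) + inversionsBetween xs (ys ++ zs)
    ≡⟨ cong₂ _+_ (countBelow-++ x ys zs) (inversionsBetween-++ʳ xs ys zs) ⟩
  (countBelow x ys + countBelow x zs) + (inversionsBetween xs ys + inversionsBetween xs zs)
    ≡⟨ interchange (countBelow x ys) (countBelow x zs) _ _ ⟩
  (countBelow x ys + inversionsBetween xs ys) + (countBelow x zs + inversionsBetween xs zs) ∎
  where open ≡-Reasoning

inversionsBetween-∷ʳ : ∀ xs y ys →
  inversionsBetween xs (y ∷ ys) ≡ countAbove y xs + inversionsBetween xs ys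
inversionsBetween-∷ʳ []       y ys = refl
inversionsBetween-∷ʳ (x ∷ xs) y ys = begin
  countBelow x (y ∷ ys) + inversionsBetween xs (y ∷ ys)
    ≡⟨ cong₂ _+_ (countBelow-∷ x y ys) (inversionsBetween-∷ʳ xs y ys) ⟩
  (⟦ y < x ⟧ + countBelow x ys) + (countAbove y xs + inversionsBetween xs ys)
    ≡⟨ interchange ⟦ y < x ⟧ (countBelow x ys) _ _ ⟩
  (⟦ y < x ⟧ + countAbove y xs) + (countBelow x ys + inversionsBetween xs ys)
    ≡⟨ cong (_+ _) (countAbove-∷ y x xs) ⟨
  countAbove y (x ∷ xs) + inversionsBetween (x ∷ xs) ys ∎
  where open ≡-Reasoning

inversionsBetween-map-+ : ∀ {a b} → a ≤ b → ∀ xs ys →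
  inversionsBetween (map (a +_) xs) (map (b +_) ys) ≤ inversionsBetween xs ys
inversionsBetween-map-+ a≤b []       ys = z≤n
inversionsBetween-map-+ {a} {b} a≤b (x ∷ xs) ys =
  +-mono-≤ (countBelow-map (b +_) reflect ys) (inversionsBetween-map-+ a≤b xs ys)
  where
  reflect : ∀ {y} → b + y < a + x → y < x
  reflect {y} b+y<a+x = +-cancelˡ-< a y x (≤-<-trans (+-monoˡ-≤ y a≤b) b+y<a+x)

[1+m]C2≡m+mC2 : ∀ m → suc m C 2 ≡ m + m C 2
[1+m]C2≡m+mC2 m = trans (sym (nCk+nC[k+1]≡[n+1]C[k+1] m 1)) (cong (_+ m C 2) (nC1≡n m))

inversionsBetween-self : ∀ xs → inversionsBetween xs xs ≤ length xs C 2
inversionsBetween-self []       = z≤n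
inversionsBetween-self (x ∷ xs) = begin
  countBelow x (x ∷ xs) + inversionsBetween xs (x ∷ xs)
    ≡⟨ cong₂ _+_ (countBelow-∷ x x xs) (inversionsBetween-∷ʳ xs x xs) ⟩
  (⟦ x < x ⟧ + countBelow x xs) + (countAbove x xs + inversionsBetween xs xs)
    ≡⟨ cong (λ z → (z + countBelow x xs) + (countAbove x xs + inversionsBetween xs xs))
            (⟦<⟧≡0 (≤-refl {x})) ⟩
  countBelow x xs + (countAbove x xs + inversionsBetween xs xs)
    ≡⟨ +-assoc (countBelow x xs) _ _ ⟨
  (countBelow x xs + countAbove x xs) + inversionsBetween xs xs
    ≤⟨ +-mono-≤ (countBelow+countAbove≤length x xs) (inversionsBetween-self xs) ⟩
  length xs + length xs C 2
    ≡⟨ [1+m]C2≡m+mC2 (length xs) ⟨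
  suc (length xs) C 2 ∎
  where open ≤-Reasoning

inversions-++ : ∀ xs ys →
  inversions (xs ++ ys) ≡ inversions xs + inversions ys + inversionsBetween xs ys
inversions-++ []       ys = sym (+-identityʳ (inversions ys))
inversions-++ (x ∷ xs) ys = begin
  countBelow x (xs ++ ys) + inversions (xs ++ ys)
    ≡⟨ cong₂ _+_ (countBelow-++ x xs ys) (inversions-++ xs ys) ⟩
  (countBelow x xs + countBelow x ys) + (inversions xs + inversions ys + inversionsBetween xs ys)
    ≡⟨ rearrange (countBelow x xs) (countBelow x ys) (inversions xs) _ _ ⟩
  countBelow x xs + inversions xs + inversions ys + (countBelow x ys + inversionsBetween xs ys) ∎
  where
  open ≡-Reasoning
  rearrange : ∀ a b c d e → (a + b) + (c + d + e) ≡ a + c + d + (b + e)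
  rearrange = solve-∀

inversions-map-+ : ∀ d xs → inversions (map (d +_) xs) ≤ inversions xs
inversions-map-+ d []       = z≤n
inversions-map-+ d (x ∷ xs) =
  +-mono-≤ (countBelow-map (d +_) (+-cancelˡ-< d _ x) xs) (inversions-map-+ d xs)

inversions-increasing : ∀ {xs} → AllPairs _<_ xs → inversions xs ≡ 0
inversions-increasing []               = refl
inversions-increasing {x ∷ xs} (x<xs ∷ xs↑) =
  cong₂ _+_ (cong length (filter-none (λ y → y <? x) (All.map (λ x<y → <⇒≯ x<y) x<xs)))
            (inversions-increasing xs↑)

descents-++ : ∀ xs ys → descents (xs ++ ys) ≤ descents xs + suc (descents ys)
descents-++ []           ys       = n≤1+n _
descents-++ (x ∷ [])     []       = z≤n
descents-++ (x ∷ [])     (y ∷ ys) = +-monoˡ-≤ (descents (y ∷ ys)) (⟦<⟧≤1 x y)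
descents-++ (x ∷ y ∷ xs) ys       = begin
  ⟦ y < x ⟧ + descents (y ∷ xs ++ ys)                 ≤⟨ +-monoʳ-≤ ⟦ y < x ⟧ (descents-++ (y ∷ xs) ys) ⟩
  ⟦ y < x ⟧ + (descents (y ∷ xs) + suc (descents ys)) ≡⟨ +-assoc ⟦ y < x ⟧ _ _ ⟨
  ⟦ y < x ⟧ + descents (y ∷ xs) + suc (descents ys)   ∎
  where open ≤-Reasoning

descents-map-+ : ∀ d xs → descents (map (d +_) xs) ≤ descents xs
descents-map-+ d []           = z≤n
descents-map-+ d (x ∷ [])     = z≤n
descents-map-+ d (x ∷ y ∷ xs) = +-mono-≤ (⟦<⟧-mono (+-cancelˡ-< d y x)) (descents-map-+ d (y ∷ xs))

descents-increasing : ∀ {xs} → AllPairs _<_ xs → descents xs ≡ 0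
descents-increasing []                        = refl
descents-increasing (_ ∷ [])                  = refl
descents-increasing ((x<y ∷ _) ∷ y∷xs↑@(_ ∷ _)) =
  cong₂ _+_ (⟦<⟧≡0 (<⇒≤ x<y)) (descents-increasing y∷xs↑)

module _ {A : Set} (f : A → List ℕ) where

  length-concatMap : ∀ {m} → (∀ j → length (f j) ≡ m) → ∀ js → length (concatMap f js) ≡ length js * m
  length-concatMap same []       = refl
  length-concatMap same (j ∷ js) = trans (length-++ (f j)) (cong₂ _+_ (same j) (length-concatMap same js))

  descents-concatMap : ∀ {d} → (∀ j → descents (f j) ≤ d) → ∀ j js →
                       suc (descents (concatMap f (j ∷ js))) ≤ length (j ∷ js) * suc d
  descents-concatMap {d} bound j [] = s≤s (begin
    descents (f j ++ [])  ≡⟨ cong descents (++-identityʳ (f j)) ⟩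
    descents (f j)        ≤⟨ bound j ⟩
    d                     ≡⟨ +-identityʳ d ⟨
    d + 0                 ∎)
    where open ≤-Reasoning
  descents-concatMap {d} bound j (j′ ∷ js) = begin
    suc (descents (f j ++ concatMap f (j′ ∷ js)))
      ≤⟨ s≤s (descents-++ (f j) _) ⟩
    suc (descents (f j) + suc (descents (concatMap f (j′ ∷ js))))
      ≤⟨ s≤s (+-mono-≤ (bound j) (descents-concatMap bound j′ js)) ⟩
    suc (d + length (j′ ∷ js) * suc d) ∎
    where open ≤-Reasoning

  inversionsBetween-concatMapʳ : ∀ {c} xs js → All (λ j → inversionsBetween xs (f j) ≤ c) js →
                                 inversionsBetween xs (concatMap f js) ≤ length js * c
  inversionsBetween-concatMapʳ xs []       []       = ≤-reflexive (inversionsBetween-[]ʳ xs)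
  inversionsBetween-concatMapʳ {c} xs (j ∷ js) (b ∷ bs) = begin
    inversionsBetween xs (f j ++ concatMap f js)
      ≡⟨ inversionsBetween-++ʳ xs (f j) _ ⟩
    inversionsBetween xs (f j) + inversionsBetween xs (concatMap f js)
      ≤⟨ +-mono-≤ b (inversionsBetween-concatMapʳ xs js bs) ⟩
    c + length js * c ∎
    where open ≤-Reasoning

  inversions-concatMap : ∀ {i c} → (∀ j → inversions (f j) ≤ i) → ∀ js →
                         AllPairs (λ a b → inversionsBetween (f a) (f b) ≤ c) js →
                         inversions (concatMap f js) ≤ length js * i + (length js C 2) * c
  inversions-concatMap bound []       []       = z≤n
  inversions-concatMap {i} {c} bound (j ∷ js) (b ∷ bs) = begin
    inversions (f j ++ concatMap f js)
      ≡⟨ inversions-++ (f j) _ ⟩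
    inversions (f j) + inversions (concatMap f js) + inversionsBetween (f j) (concatMap f js)
      ≤⟨ +-mono-≤ (+-mono-≤ (bound j) (inversions-concatMap bound js bs))
                  (inversionsBetween-concatMapʳ (f j) js b) ⟩
    i + (m * i + (m C 2) * c) + m * c
      ≡⟨ rearrange i m (m C 2) c ⟩
    suc m * i + (m + m C 2) * c
      ≡⟨ cong (λ z → suc m * i + z * c) ([1+m]C2≡m+mC2 m) ⟨
    suc m * i + (suc m C 2) * c ∎
    where
    open ≤-Reasoning
    m = length js
    rearrange : ∀ i m C c → i + (m * i + C * c) + m * c ≡ suc m * i + (m + C) * c
    rearrange = solve-∀

shiftedCopies : ℕ → ℕ → List ℕ → List ℕ
shiftedCopies k s xs = concatMap (λ j → map (j * s +_) xs) (upTo k)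

length-shiftedCopies : ∀ k s xs → length (shiftedCopies k s xs) ≡ k * length xs
length-shiftedCopies k s xs =
  trans (length-concatMap _ (λ j → length-map (j * s +_) xs) (upTo k)) (cong (_* length xs) (length-upTo k))

j*s+x<j′*s : ∀ {s x j j′} → x < s → j < j′ → j * s + x < j′ * s
j*s+x<j′*s {s} {x} {j} {j′} x<s j<j′ = begin-strict
  j * s + x  <⟨ +-monoʳ-< (j * s) x<s ⟩
  j * s + s  ≡⟨ +-comm (j * s) s ⟩
  suc j * s  ≤⟨ *-monoˡ-≤ s j<j′ ⟩
  j′ * s     ∎
  where open ≤-Reasoning

shiftedCopies-bounded : ∀ k s {xs} → All (_< s) xs → All (_< k * s) (shiftedCopies k s xs)
shiftedCopies-bounded k s xs<s =
  All.concat⁺ (All.map⁺ (All.applyUpTo⁺₁ _ k λ j<k → All.map⁺ (All.map (λ x<s → j*s+x<j′*s x<s j<k) xs<s)))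

shiftedCopies-increasing : ∀ k s {xs} → AllPairs _<_ xs → All (_< s) xs →
                           AllPairs _<_ (shiftedCopies k s xs)
shiftedCopies-increasing k s {xs} xs↑ xs<s =
  AllPairs.concat⁺
    (All.map⁺ (All.universal (λ j → AllPairs.map⁺ (AllPairs.map (+-monoʳ-< (j * s)) xs↑)) (upTo k)))
                   (AllPairs.map⁺ (AllPairs.map separated (upTo-increasing k)))
  where
  separated : ∀ {j j′} → j < j′ → All (λ x → All (x <_) (map (j′ * s +_) xs)) (map (j * s +_) xs)
  separated {j} {j′} j<j′ = All.map⁺ (All.map (λ x<s → All.map⁺ (All.universal
    (λ y → ≤-trans (j*s+x<j′*s x<s j<j′) (m≤m+n (j′ * s) y)) xs)) xs<s)

descents-shiftedCopies : ∀ k .{{_ : NonZero k}} s xs →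
                         suc (descents (shiftedCopies k s xs)) ≤ k * suc (descents xs)
descents-shiftedCopies k@(suc k-1) s xs = begin
  suc (descents (shiftedCopies k s xs))
    ≤⟨ descents-concatMap (λ j → map (j * s +_) xs) (λ j → descents-map-+ (j * s) xs) 0 (applyUpTo suc k-1) ⟩
  length (upTo k) * suc (descents xs)
    ≡⟨ cong (_* suc (descents xs)) (length-upTo k) ⟩
  k * suc (descents xs) ∎
  where open ≤-Reasoning

inversions-shiftedCopies : ∀ k s xs →
  inversions (shiftedCopies k s xs) ≤ k * inversions xs + (k C 2) * (length xs C 2)
inversions-shiftedCopies k s xs = begin
  inversions (shiftedCopies k s xs)
    ≤⟨ inversions-concatMap (λ j → map (j * s +_) xs) (λ j → inversions-map-+ (j * s) xs) (upTo k) crossings ⟩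
  length (upTo k) * inversions xs + (length (upTo k) C 2) * (length xs C 2)
    ≡⟨ cong (λ m → m * inversions xs + (m C 2) * (length xs C 2)) (length-upTo k) ⟩
  k * inversions xs + (k C 2) * (length xs C 2) ∎
  where
  open ≤-Reasoning
  crossings : AllPairs (λ a b → inversionsBetween (map (a * s +_) xs) (map (b * s +_) xs) ≤ length xs C 2) (upTo k)
  crossings = AllPairs.map (λ a<b → ≤-trans (inversionsBetween-map-+ (*-monoˡ-≤ s (<⇒≤ a<b)) xs xs)
                                            (inversionsBetween-self xs))
                           (upTo-increasing k)

-- patterns k (e₁ ∷ … ∷ eₘ) lists Σ jᵢ k^eᵢ over all 0 ≤ jᵢ < k, lexicographically in (j₁, …, jₘ).
patterns : ℕ → List ℕ → List ℕ
patterns k []       = [ 0 ]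
patterns k (e ∷ es) = shiftedCopies k (k ^ e) (patterns k es)

length-patterns : ∀ k es → length (patterns k es) ≡ k ^ length es
length-patterns k []       = refl
length-patterns k (e ∷ es) = trans (length-shiftedCopies k (k ^ e) (patterns k es))
                                   (cong (k *_) (length-patterns k es))

patterns-bounded : ∀ k .{{_ : NonZero k}} {e es} → AllPairs _>_ es → All (_< e) es →
                   All (_< k ^ e) (patterns k es)
patterns-bounded k {e} []             []          = m^n>0 k e ∷ []
patterns-bounded k {e} (e′>es ∷ es↓) (e′<e ∷ _) =
  All.map (λ x<k^[1+e′] → <-≤-trans x<k^[1+e′] (^-monoʳ-≤ k e′<e))
          (shiftedCopies-bounded k _ (patterns-bounded k es↓ e′>es))

patterns-increasing : ∀ k .{{_ : NonZero k}} {es} → AllPairs _>_ es → AllPairs _<_ (patterns k es)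
patterns-increasing k []            = [] ∷ []
patterns-increasing k (e>es ∷ es↓) =
  shiftedCopies-increasing k _ (patterns-increasing k es↓) (patterns-bounded k es↓ e>es)

sum1-cong : ∀ m {f g : ℕ → ℕ} → (∀ i → f (suc i) ≡ g (suc i)) → sum1 m f ≡ sum1 m g
sum1-cong zero    f≗g = refl
sum1-cong (suc m) f≗g = cong₂ _+_ (sum1-cong m f≗g) (f≗g m)

sum1-suc : ∀ t (f : ℕ → ℕ) → sum1 (suc t) f ≡ f 1 + sum1 t (λ i → f (suc i))
sum1-suc zero    f = sym (+-identityʳ (f 1))
sum1-suc (suc t) f = trans (cong (_+ f (suc (suc t))) (sum1-suc t f)) (+-assoc (f 1) _ _)

sum1-*ˡ : ∀ t k (f : ℕ → ℕ) → sum1 t (λ i → k * f i) ≡ k * sum1 t f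
sum1-*ˡ zero    k f = sym (*-zeroʳ k)
sum1-*ˡ (suc t) k f = trans (cong (_+ k * f (suc t)) (sum1-*ˡ t k f)) (sym (*-distribˡ-+ k _ _))

sum1-mono : ∀ (f : ℕ → ℕ) {m m′} → m ≤ m′ → sum1 m f ≤ sum1 m′ f
sum1-mono f {m′ = zero}   z≤n   = z≤n
sum1-mono f {m′ = suc m′} m≤1+m′ with m≤n⇒m<n∨m≡n m≤1+m′
... | inj₁ m<1+m′ = ≤-trans (sum1-mono f (≤-pred m<1+m′)) (m≤m+n (sum1 m′ f) _)
... | inj₂ refl   = ≤-refl

sum1-geometric : ∀ k .{{_ : NonZero k}} t → sum1 t (λ j → (k ∸ 1) * k ^ (j ∸ 1)) + 1 ≡ k ^ t
sum1-geometric k         zero    = refl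
sum1-geometric k@(suc k-1) (suc t) = begin
  sum1 t g + k-1 * k ^ t + 1  ≡⟨ xy∙z≈xz∙y (sum1 t g) _ 1 ⟩
  sum1 t g + 1 + k-1 * k ^ t  ≡⟨ cong (_+ k-1 * k ^ t) (sum1-geometric k t) ⟩
  k ^ t + k-1 * k ^ t         ∎
  where
  open ≡-Reasoning
  g = λ j → k-1 * k ^ (j ∸ 1)

inversionSum : ℕ → ℕ → ℕ → ℕ
inversionSum k N t = sum1 t (λ i → k ^ (i ∸ 1) * ((k ^ (N ∸ i)) C 2))

inversionSum-suc : ∀ k N t → inversionSum k (suc N) (suc t) ≡ (k ^ N) C 2 + k * inversionSum k N t
inversionSum-suc k N t = begin
  sum1 (suc t) F′
    ≡⟨ sum1-suc t F′ ⟩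
  F′ 1 + sum1 t (λ i → F′ (suc i))
    ≡⟨ cong₂ _+_ (*-identityˡ _) (sum1-cong t (λ i → *-assoc k (k ^ i) _)) ⟩
  (k ^ N) C 2 + sum1 t (λ i → k * F i)
    ≡⟨ cong ((k ^ N) C 2 +_) (sum1-*ˡ t k F) ⟩
  (k ^ N) C 2 + k * sum1 t F ∎
  where
  open ≡-Reasoning
  F  = λ i → k ^ (i ∸ 1) * ((k ^ (N ∸ i)) C 2)
  F′ = λ i → k ^ (i ∸ 1) * ((k ^ (suc N ∸ i)) C 2)

descents-patterns-++ : ∀ k .{{_ : NonZero k}} pre {post} → AllPairs _>_ post →
                       suc (descents (patterns k (pre ++ post))) ≤ k ^ length pre
descents-patterns-++ k []        post↓ = ≤-reflexive (cong suc (descents-increasing (patterns-increasing k post↓)))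
descents-patterns-++ k (e ∷ pre) post↓ =
  ≤-trans (descents-shiftedCopies k (k ^ e) _) (*-monoʳ-≤ k (descents-patterns-++ k pre post↓))

inversions-patterns-++ : ∀ k .{{_ : NonZero k}} pre {post} → AllPairs _>_ post →
  inversions (patterns k (pre ++ post)) ≤ (k C 2) * inversionSum k (length (pre ++ post)) (length pre)
inversions-patterns-++ k []        post↓ =
  ≤-trans (≤-reflexive (inversions-increasing (patterns-increasing k post↓))) z≤n
inversions-patterns-++ k (e ∷ pre) {post} post↓ = begin
  inversions (shiftedCopies k (k ^ e) L)
    ≤⟨ inversions-shiftedCopies k (k ^ e) L ⟩
  k * inversions L + c * (length L C 2)
    ≤⟨ +-monoˡ-≤ _ (*-monoʳ-≤ k (inversions-patterns-++ k pre post↓)) ⟩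
  k * (c * S) + c * (length L C 2)
    ≡⟨ cong (λ m → k * (c * S) + c * (m C 2)) (length-patterns k (pre ++ post)) ⟩
  k * (c * S) + c * ((k ^ N) C 2)
    ≡⟨ rearrange k c S ((k ^ N) C 2) ⟩
  c * ((k ^ N) C 2 + k * S)
    ≡⟨ cong (c *_) (inversionSum-suc k N (length pre)) ⟨
  c * inversionSum k (suc N) (suc (length pre)) ∎
  where
  open ≤-Reasoning
  L = patterns k (pre ++ post)
  N = length (pre ++ post)
  c = k C 2
  S = inversionSum k N (length pre)
  rearrange : ∀ k c S X → k * (c * S) + c * X ≡ c * (X + k * S)
  rearrange = solve-∀

descents-patterns≤ : ∀ k .{{_ : NonZero k}} t es → AllPairs _>_ (drop t es) →
                     descents (patterns k es) ≤ sum1 t (λ j → (k ∸ 1) * k ^ (j ∸ 1))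
descents-patterns≤ k t es tail↓ = ≤-pred (begin
  suc (descents (patterns k es))
    ≡⟨ cong (λ xs → suc (descents (patterns k xs))) (take++drop≡id t es) ⟨
  suc (descents (patterns k (take t es ++ drop t es)))
    ≤⟨ descents-patterns-++ k (take t es) tail↓ ⟩
  k ^ length (take t es)
    ≤⟨ ^-monoʳ-≤ k (length-take≤ t es) ⟩
  k ^ t
    ≡⟨ trans (+-comm 1 _) (sum1-geometric k t) ⟨
  suc (sum1 t (λ j → (k ∸ 1) * k ^ (j ∸ 1))) ∎)
  where open ≤-Reasoning

inversions-patterns≤ : ∀ k .{{_ : NonZero k}} t es → AllPairs _>_ (drop t es) →
                       inversions (patterns k es) ≤ (k C 2) * inversionSum k (length es) t
inversions-patterns≤ k t es tail↓ =
  subst (λ xs → inversions (patterns k xs) ≤ (k C 2) * inversionSum k (length xs) t) (take++drop≡id t es)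
        (≤-trans (inversions-patterns-++ k (take t es) tail↓)
                 (*-monoʳ-≤ (k C 2) (sum1-mono _ (length-take≤ t es))))

-- Base-k digits

module Digits (k : ℕ) .{{_ : NonZero k}} where

  infixl 7 _/k^_

  _/k^_ : ℕ → ℕ → ℕ
  c /k^ e = (c / k ^ e) {{m^n≢0 k e}}

  digitAt : ℕ → ℕ → ℕ
  digitAt e c = c /k^ e % k

  digitAt-zero : ∀ e → digitAt e 0 ≡ 0
  digitAt-zero e = trans (cong (_% k) (0/n≡0 (k ^ e) {{m^n≢0 k e}})) (m<n⇒m%n≡m (>-nonZero⁻¹ k))

  /k^-+ : ∀ c e f → c /k^ e /k^ f ≡ c /k^ (e + f)
  /k^-+ c e f = trans (m/n/o≡m/[n*o] c (k ^ e) (k ^ f) {{m^n≢0 k e}} {{m^n≢0 k f}} {{nz}})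
                      (/-congʳ {{nz}} {{m^n≢0 k (e + f)}} (sym (^-distribˡ-+-* k e f)))
    where
    nz : NonZero (k ^ e * k ^ f)
    nz = subst NonZero (^-distribˡ-+-* k e f) (m^n≢0 k (e + f))

  /-/k^ : ∀ c e → c / k /k^ e ≡ c /k^ suc e
  /-/k^ c e = m/n/o≡m/[n*o] c k (k ^ e) {{_}} {{m^n≢0 k e}} {{m^n≢0 k (suc e)}}

  /k^-suc : ∀ c e → c /k^ suc e ≡ c /k^ e / k
  /k^-suc c e = trans (/-congʳ {{m^n≢0 k (suc e)}} {{nz}} (*-comm k (k ^ e)))
                      (sym (m/n/o≡m/[n*o] c (k ^ e) k {{m^n≢0 k e}} {{_}} {{nz}}))
    where
    nz : NonZero (k ^ e * k)
    nz = subst NonZero (*-comm k (k ^ e)) (m^n≢0 k (suc e))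

  [j*k^e+v]/k^e : ∀ j v e → (j * k ^ e + v) /k^ e ≡ j + v /k^ e
  [j*k^e+v]/k^e j v e = trans (+-distrib-/-∣ˡ v {{m^n≢0 k e}} (divides-refl j))
                               (cong (_+ v /k^ e) (m*n/n≡m j (k ^ e) {{m^n≢0 k e}}))

  -- A vanishing digit at e lets j < k be placed there without carry: v / k^e = q k, so
  -- (j k^e + v) / k^e = j + q k has last digit j and the same higher part q.
  module _ {j v e : ℕ} (j<k : j < k) (vₑ≡0 : digitAt e v ≡ 0) where

    private
      q = v /k^ e / k

      [j*k^e+v]/k^e≡j+q*k : (j * k ^ e + v) /k^ e ≡ j + q * k
      [j*k^e+v]/k^e≡j+q*k = trans ([j*k^e+v]/k^e j v e)
        (cong (j +_) (trans (m≡m%n+[m/n]*n (v /k^ e) k) (cong (_+ q * k) vₑ≡0)))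

    digitAt-+-here : digitAt e (j * k ^ e + v) ≡ j
    digitAt-+-here = begin
      (j * k ^ e + v) /k^ e % k ≡⟨ cong (_% k) [j*k^e+v]/k^e≡j+q*k ⟩
      (j + q * k) % k           ≡⟨ [m+kn]%n≡m%n j q k ⟩
      j % k                     ≡⟨ m<n⇒m%n≡m j<k ⟩
      j                         ∎
      where open ≡-Reasoning

    /k^-+-above : ∀ {e′} → e < e′ → (j * k ^ e + v) /k^ e′ ≡ v /k^ e′
    /k^-+-above e<e′ with m≤n⇒∃[o]m+o≡n e<e′
    ... | f , refl = begin
      (j * k ^ e + v) /k^ (suc e + f) ≡⟨ /k^-+ _ (suc e) f ⟨
      (j * k ^ e + v) /k^ suc e /k^ f ≡⟨ cong (_/k^ f) (trans (/k^-suc _ e) quotient) ⟩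
      v /k^ suc e /k^ f               ≡⟨ /k^-+ v (suc e) f ⟩
      v /k^ (suc e + f)               ∎
      where
      open ≡-Reasoning
      quotient : (j * k ^ e + v) /k^ e / k ≡ v /k^ suc e
      quotient = begin
        (j * k ^ e + v) /k^ e / k ≡⟨ cong (_/ k) [j*k^e+v]/k^e≡j+q*k ⟩
        (j + q * k) / k           ≡⟨ +-distrib-/-∣ʳ j (divides-refl q) ⟩
        j / k + q * k / k         ≡⟨ cong₂ _+_ (m<n⇒m/n≡0 j<k) (m*n/n≡m q k) ⟩
        q                         ≡⟨ /k^-suc v e ⟨
        v /k^ suc e               ∎

  digitAt-+-below : ∀ {e′ e} j v → e′ < e → digitAt e′ (j * k ^ e + v) ≡ digitAt e′ v
  digitAt-+-below {e′} j v e′<e with m≤n⇒∃[o]m+o≡n e′<e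
  ... | f , refl = begin
    (j * k ^ (suc e′ + f) + v) /k^ e′ % k         ≡⟨ cong (λ x → (x + v) /k^ e′ % k) split ⟩
    ((j * k ^ f) * k * k ^ e′ + v) /k^ e′ % k     ≡⟨ cong (_% k) ([j*k^e+v]/k^e ((j * k ^ f) * k) v e′) ⟩
    ((j * k ^ f) * k + v /k^ e′) % k              ≡⟨ cong (_% k) (+-comm ((j * k ^ f) * k) _) ⟩
    (v /k^ e′ + (j * k ^ f) * k) % k              ≡⟨ [m+kn]%n≡m%n (v /k^ e′) (j * k ^ f) k ⟩
    v /k^ e′ % k                                  ∎
    where
    open ≡-Reasoning
    split : j * k ^ (suc e′ + f) ≡ (j * k ^ f) * k * k ^ e′
    split = trans (cong (j *_) (^-distribˡ-+-* k (suc e′) f)) (rearrange j (k ^ e′) (k ^ f) k)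
      where
      rearrange : ∀ j a b k → j * (k * a * b) ≡ j * b * k * a
      rearrange = solve-∀

  digitAt-+-other : ∀ {e e′ j v} → e′ ≢ e → j < k → digitAt e v ≡ 0 →
                    digitAt e′ (j * k ^ e + v) ≡ digitAt e′ v
  digitAt-+-other {e} {e′} {j} {v} e′≢e j<k vₑ≡0 with <-cmp e′ e
  ... | tri< e′<e _ _ = digitAt-+-below j v e′<e
  ... | tri≈ _ e′≡e _ = contradiction e′≡e e′≢e
  ... | tri> _ _ e<e′ = cong (_% k) (/k^-+-above j<k vₑ≡0 e<e′)

  digits-injective : ∀ m {c v} → c < k ^ m → v < k ^ m →
                     (∀ e → e < m → digitAt e c ≡ digitAt e v) → c ≡ v
  digits-injective zero    (s≤s z≤n) (s≤s z≤n) _ = refl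
  digits-injective (suc m) {c} {v} c<k^[1+m] v<k^[1+m] same = begin
    c                   ≡⟨ m≡m%n+[m/n]*n c k ⟩
    c % k + (c / k) * k ≡⟨ cong₂ (λ r q → r + q * k) (trans (sym (lastDigit c)) (trans (same 0 z<s) (lastDigit v)))
                                                      (digits-injective m (shift c<k^[1+m]) (shift v<k^[1+m]) sameAbove) ⟩
    v % k + (v / k) * k ≡⟨ m≡m%n+[m/n]*n v k ⟨
    v                   ∎
    where
    open ≡-Reasoning
    lastDigit : ∀ x → digitAt 0 x ≡ x % k
    lastDigit x = cong (_% k) (n/1≡n x)
    shift : ∀ {x} → x < k ^ suc m → x / k < k ^ m
    shift {x} x<k^[1+m] = m<n*o⇒m/o<n (subst (x <_) (*-comm k (k ^ m)) x<k^[1+m])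
    sameAbove : ∀ e → e < m → digitAt e (c / k) ≡ digitAt e (v / k)
    sameAbove e e<m = begin
      c / k /k^ e % k ≡⟨ cong (_% k) (/-/k^ c e) ⟩
      c /k^ suc e % k ≡⟨ same (suc e) (s<s e<m) ⟩
      v /k^ suc e % k ≡⟨ cong (_% k) (/-/k^ v e) ⟨
      v / k /k^ e % k ∎

exponent : ∀ {n} → Fin n → ℕ
exponent {n} p = n ∸ suc (toℕ p)

exponent-opposite : ∀ {n} (i : Fin n) → exponent (opposite i) ≡ toℕ i
exponent-opposite i = trans (sym (opposite-prop (opposite i))) (cong toℕ (opposite-involutive i))

exponent-injective : ∀ {n} {p q : Fin n} → exponent p ≡ exponent q → p ≡ q
exponent-injective {p = p} {q} eq = begin
  p                       ≡⟨ opposite-involutive p ⟨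
  opposite (opposite p)   ≡⟨ cong opposite (toℕ-injective toℕ-opposite≡) ⟩
  opposite (opposite q)   ≡⟨ opposite-involutive q ⟩
  q                       ∎
  where
  open ≡-Reasoning
  toℕ-opposite≡ : toℕ (opposite p) ≡ toℕ (opposite q)
  toℕ-opposite≡ = trans (opposite-prop p) (trans eq (sym (opposite-prop q)))

exponent<n : ∀ {n} (p : Fin n) → exponent p < n
exponent<n p = subst (_< _) (opposite-prop p) (toℕ<n (opposite p))

exponent-antitone : ∀ {n} {p q : Fin n} → toℕ p < toℕ q → exponent q < exponent p
exponent-antitone {q = q} p<q = ∸-monoʳ-< (s<s p<q) (toℕ<n q)

digit≡digitAt : ∀ k .{{_ : NonZero k}} n p c → digit k n p c ≡ Digits.digitAt k (exponent p) c
digit≡digitAt (suc k) n p c = refl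

module Firing (k : ℕ) .{{_ : NonZero k}} (n : ℕ) where

  open Digits k

  digitsAt : List (Fin n) → ℕ → List ℕ
  digitsAt ps c = map (λ q → digitAt (exponent q) c) ps

  withDigits : List (Fin n) → List ℕ → List ℕ → List ℕ
  withDigits ps d = filter (λ c → ≡-dec _≟_ (digitsAt ps c) d)

  withDigits-∷ : ∀ p ps j d cs →
    withDigits ps d (filter (λ c → digit k n p c ≟ j) cs) ≡ withDigits (p ∷ ps) (j ∷ d) cs
  withDigits-∷ p ps j d cs = trans (filter-filter _ _ cs) (filter-≐ _ _ (to , from) cs)
    where
    to : ∀ {c} → digit k n p c ≡ j × digitsAt ps c ≡ d → digitsAt (p ∷ ps) c ≡ j ∷ d
    to {c} (pⱼ , rest) = cong₂ _∷_ (trans (sym (digit≡digitAt k n p c)) pⱼ) rest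
    from : ∀ {c} → digitsAt (p ∷ ps) c ≡ j ∷ d → digit k n p c ≡ j × digitsAt ps c ≡ d
    from {c} eq = trans (digit≡digitAt k n p c) (∷-injectiveˡ eq) , ∷-injectiveʳ eq

  Supported : List (Fin n) → ℕ → Set
  Supported ps v = (∀ q → q ∉ ps → digitAt (exponent q) v ≡ 0) × v < k ^ n

  module _ {p : Fin n} {ps : List (Fin n)} {j v : ℕ}
           (p∉ps : All (p ≢_) ps) (j<k : j < k) (v-supported : Supported ps v) where

    private
      vₚ≡0 : digitAt (exponent p) v ≡ 0
      vₚ≡0 = proj₁ v-supported p (All.All¬⇒¬Any p∉ps)

      digitAt-shift-other : ∀ {q} → q ≢ p →
                            digitAt (exponent q) (j * k ^ exponent p + v) ≡ digitAt (exponent q) v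
      digitAt-shift-other q≢p = digitAt-+-other {e = exponent p} (q≢p ∘ exponent-injective) j<k vₚ≡0

    digitsAt-shift : digitsAt (p ∷ ps) (j * k ^ exponent p + v) ≡ j ∷ digitsAt ps v
    digitsAt-shift = cong₂ _∷_ (digitAt-+-here {v = v} {e = exponent p} j<k vₚ≡0)
                               (map-cong-local (All.map (digitAt-shift-other ∘ ≢-sym) p∉ps))

    Supported-shift : Supported (p ∷ ps) (j * k ^ exponent p + v)
    Supported-shift = vanishes , bound
      where
      vanishes : ∀ q → q ∉ p ∷ ps → digitAt (exponent q) (j * k ^ exponent p + v) ≡ 0
      vanishes q q∉p∷ps = trans (digitAt-shift-other (q∉p∷ps ∘ here)) (proj₁ v-supported q (q∉p∷ps ∘ there))
      bound : j * k ^ exponent p + v < k ^ n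
      bound = m/n≡0⇒m<n {{m^n≢0 k n}}
        (trans (/k^-+-above {v = v} {e = exponent p} j<k vₚ≡0 (exponent<n p))
               (m<n⇒m/n≡0 {{m^n≢0 k n}} (proj₂ v-supported)))

  patterns-supported : ∀ {ps} → Unique ps → All (Supported ps) (patterns k (map exponent ps))
  patterns-supported []           = ((λ q _ → digitAt-zero (exponent q)) , m^n>0 k n) ∷ []
  patterns-supported (p∉ps ∷ ps!) = All.concat⁺ (All.map⁺ (All.applyUpTo⁺₁ _ k
    (λ j<k → All.map⁺ (All.map (Supported-shift p∉ps j<k) (patterns-supported ps!)))))

  fire-patterns : ∀ {ps} → Unique ps → ∀ cs →
    fire k n cs ps ≡ concatMap (λ v → withDigits ps (digitsAt ps v) cs) (patterns k (map exponent ps))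
  fire-patterns [] cs = sym (trans (++-identityʳ _) (filter-all _ (All.universal (λ _ → refl) cs)))
  fire-patterns {p ∷ ps} (p∉ps ∷ ps!) cs = begin
    concatMap (λ j → fire k n (filter (λ c → digit k n p c ≟ j) cs) ps) (upTo k)
      ≡⟨ concatMap-cong (λ j → fire-patterns ps! _) (upTo k) ⟩
    concatMap (λ j → concatMap (λ v → withDigits ps (digitsAt ps v) (filter (λ c → digit k n p c ≟ j) cs)) V)
              (upTo k)
      ≡⟨ concatMap-cong (λ j → concatMap-cong (λ v → withDigits-∷ p ps j _ cs) V) (upTo k) ⟩
    concatMap (λ j → concatMap (λ v → withDigits (p ∷ ps) (j ∷ digitsAt ps v) cs) V) (upTo k)
      ≡⟨ concatMap-cong-local (All.applyUpTo⁺₁ _ k λ j<k → concatMap-cong-local (All.map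
           (λ v-supported → cong (λ d → withDigits (p ∷ ps) d cs) (sym (digitsAt-shift p∉ps j<k v-supported)))
           (patterns-supported ps!))) ⟩
    concatMap (λ j → concatMap (λ v → F (j * k ^ exponent p + v)) V) (upTo k)
      ≡⟨ concatMap-cong (λ j → sym (concatMap-map F (j * k ^ exponent p +_) V)) (upTo k) ⟩
    concatMap (λ j → concatMap F (map (j * k ^ exponent p +_) V)) (upTo k)
      ≡⟨ MonadProperties.associative (upTo k) (λ j → map (j * k ^ exponent p +_) V) F ⟩
    concatMap F (patterns k (map exponent (p ∷ ps))) ∎
    where
    open ≡-Reasoning
    V = patterns k (map exponent ps)
    F = λ v → withDigits (p ∷ ps) (digitsAt (p ∷ ps) v) cs

  digitsAt-injective : ∀ {ps} → (∀ q → q ∈ ps) → ∀ {c v} → c < k ^ n → v < k ^ n →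
                       digitsAt ps c ≡ digitsAt ps v → c ≡ v
  digitsAt-injective complete {c} {v} c<k^n v<k^n same = digits-injective n c<k^n v<k^n sameDigit
    where
    sameDigit : ∀ e → e < n → digitAt e c ≡ digitAt e v
    sameDigit e e<n = subst (λ e → digitAt e c ≡ digitAt e v)
      (trans (exponent-opposite (fromℕ< e<n)) (toℕ-fromℕ< e<n))
      (map-≡-∈ same (complete (opposite (fromℕ< e<n))))

  fire-complete : ∀ {ps} → Unique ps → (∀ q → q ∈ ps) →
                  fire k n (upTo (k ^ n)) ps ≡ patterns k (map exponent ps)
  fire-complete {ps} ps! complete = begin
    fire k n (upTo (k ^ n)) ps
      ≡⟨ fire-patterns ps! (upTo (k ^ n)) ⟩
    concatMap (λ v → withDigits ps (digitsAt ps v) (upTo (k ^ n))) (patterns k (map exponent ps))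
      ≡⟨ concatMap-cong-local (All.map (singleton ∘ proj₂) (patterns-supported ps!)) ⟩
    concatMap [_] (patterns k (map exponent ps))
      ≡⟨ concatMap-pure _ ⟩
    patterns k (map exponent ps) ∎
    where
    open ≡-Reasoning
    singleton : ∀ {v} → v < k ^ n → withDigits ps (digitsAt ps v) (upTo (k ^ n)) ≡ [ v ]
    singleton v<k^n = filter-upTo-unique _ v<k^n refl (λ c<k^n same → digitsAt-injective complete c<k^n v<k^n same)

module _ {n} (w : Permutation′ n) where

  positions-unique : Unique (map (w ⟨$⟩ʳ_) (allFin n))
  positions-unique = Unique.map⁺ (λ eq → trans (sym (inverseˡ w)) (trans (cong (w ⟨$⟩ˡ_) eq) (inverseˡ w)))
                                 (Unique.allFin⁺ n)

  positions-complete : ∀ q → q ∈ map (w ⟨$⟩ʳ_) (allFin n)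
  positions-complete q = subst (_∈ _) (inverseʳ w) (∈-map⁺ (w ⟨$⟩ʳ_) (∈-allFin (w ⟨$⟩ˡ q)))

config≡patterns : ∀ k .{{_ : NonZero k}} n (w : Permutation′ n) →
                  config k n w ≡ patterns k (tabulate (exponent ∘ (w ⟨$⟩ʳ_)))
config≡patterns k n w = trans (Firing.fire-complete k n (positions-unique w) (positions-complete w))
  (cong (patterns k) (trans (cong (map exponent) (map-tabulate (λ i → i) (w ⟨$⟩ʳ_))) (map-tabulate _ exponent)))

proposition6p2 : (k n : ℕ) → 2 ≤ k → (w : Permutation′ n) → (i₀ : ℕ)
    → ((a b : Fin n) → toℕ b ≡ suc (toℕ a) → i₀ ≤ suc (toℕ a)
    → toℕ (w ⟨$⟩ʳ a) < toℕ (w ⟨$⟩ʳ b))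
    → (descents (config k n w) ≤ sum1 (i₀ ∸ 1) (λ j → (k ∸ 1) * k ^ (j ∸ 1)))
    × (inversions (config k n w)
    ≤ (k C 2) * sum1 (i₀ ∸ 1) (λ i → k ^ (i ∸ 1) * ((k ^ (n ∸ i)) C 2)))
proposition6p2 k n 2≤k w i₀ increasing =
    subst (λ xs → descents xs ≤ _) (sym config≡) (descents-patterns≤ k t es tail↓)
  , subst₂ (λ xs N → inversions xs ≤ (k C 2) * inversionSum k N t)
           (sym config≡) (length-tabulate _) (inversions-patterns≤ k t es tail↓)
  where
  instance
    k≢0 : NonZero k
    k≢0 = >-nonZero (≤-trans (s≤s z≤n) 2≤k)
  t = i₀ ∸ 1
  es = tabulate (exponent ∘ (w ⟨$⟩ʳ_))
  config≡ = config≡patterns k n w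
  tail↓ : AllPairs _>_ (drop t es)
  tail↓ = Linked⇒AllPairs (λ y<x z<y → <-trans z<y y<x) (linked-drop-tabulate _ t λ a b b≡1+a t≤a →
            exponent-antitone (increasing a b b≡1+a (≤-trans (m≤n+m∸n i₀ 1) (s≤s t≤a))))
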